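{- A classical nonnesting partition $\pi$ for $D_n$ is uniquely determined by the values of $a(\pi)$, $\mu(\pi)$, $\nu(\pi)$ and $c(\pi)$.
   Context: Let $\Lambda=\{1,\dots,n,-1,\dots,-n,0\}$. For a subspace $L\subseteq\mathbb R^n$ that is an intersection of (possibly zero) hyperplanes $x_i=x_j$, $x_i=-x_j$ ($i\ne j$), let $\mathrm{Part}(L)$ be the partition of $\Lambda$ where, with $x_{ -i}:=-x_i$, $x_0:=0$, $s,t$ lie in the same block iff $x_s=x_t$ for all $x\in L$; these are the classical partitions for $D_n$. Consider the strict weak order on $\{\pm1,\dots,\pm n\}$ in which $s<t$ iff $s<t$ as integers and $\{s,t\}\ne\{ -1,1\}$ (so $-n<\dots<-2<\pm1<2<\dots<n$ with $1,-1$ incomparable); $0$ is ignored. For a partition $P$, $G(P)$ has an edge $(s,s')$ when $s<s'$ lie in a common block and no element $s''$ of that block has $s<s''<s'$. A classical nonnesting partition for $D_n$ is a classical partition for $D_n$ such that $G(P)$ has no two edges $(a,d),(b,c)$ with $a<b$, $b<c$, $c<d$ in this order. Statistics (here elements of $\{2,\dots,n\}$ are called positive, and $\pm1$ are regarded as neither positive nor negative, hence nonpositive): a block is switching if it contains a positive element and a nonpositive element; positive nonswitching if all its elements are positive. With $M_1,\dots,M_m$ the positive nonswitching blocks ordered by increasing least element, $a(\pi)=(\min M_i)_i$ and $\mu(\pi)=(|M_i|)_i$; with $P_1,\dots,P_k$ the switching blocks ordered by increasing least positive element, $\nu(\pi)=(\nu_1,\dots,\nu_k)$, $\nu_i$ the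 number of positive elements of $P_i$. With $R_1,\dots,R_l$ the blocks containing a positive element and an element of $\{1,-1\}$, ordered by increasing least positive element, $c(\pi)=(R_1\cap\{1,-1\},\dots,R_l\cap\{1,-1\})$. -}

module Defs where

open import Data.Bool using (Bool; true; false; _∧_; _∨_; not)
open import Data.Nat using (ℕ; zero; suc; _+_; _∸_; _<ᵇ_; _≡ᵇ_)
open import Data.Fin using (Fin; toℕ)
open import Data.List using (List; []; _∷_; _++_; map; allFin; filterᵇ; length)
open import Data.Bool.ListAction using (all; any)
open import Data.List.Relation.Unary.All using (All)
open import Data.Product using (Σ; _×_; _,_)
open import Data.Empty using (⊥)
open import Data.Rational using (ℚ; 0ℚ; -_)
open import Relation.Binary.PropositionalEquality using (_≡_; _≢_)
open import Function.Bundles using (_⇔_)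

-- The index set Λ = {1,…,n,-1,…,-n,0}.
-- pos i stands for the integer i+1 (i : Fin n), neg i for -(i+1), zer for 0.
data Λ (n : ℕ) : Set where
  pos : Fin n → Λ n
  neg : Fin n → Λ n
  zer : Λ n

allΛ : (n : ℕ) → List (Λ n)
allΛ n = map pos (allFin n) ++ (map neg (allFin n) ++ (zer ∷ []))

data Hyp (n : ℕ) : Set where
  hEq  : (i j : Fin n) → i ≢ j → Hyp n
  hOpp : (i j : Fin n) → i ≢ j → Hyp n

Pt : ℕ → Set
Pt n = Fin n → ℚ

OnHyp : {n : ℕ} → Pt n → Hyp n → Set
OnHyp x (hEq i j _)  = x i ≡ x j
OnHyp x (hOpp i j _) = x i ≡ - x j

InL : {n : ℕ} → List (Hyp n) → Pt n → Set
InL H x = All (OnHyp x) H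

coord : {n : ℕ} → Pt n → Λ n → ℚ
coord x (pos i) = x i
coord x (neg i) = - x i
coord x zer     = 0ℚ

-- A partition of Λ, given by its (decidable) relation "same block".
Partition : ℕ → Set
Partition n = Λ n → Λ n → Bool

IsPart : {n : ℕ} → List (Hyp n) → Partition n → Set
IsPart {n} H P = (s t : Λ n) → (P s t ≡ true) ⇔ ((x : Pt n) → InL H x → coord x s ≡ coord x t)

Classical : {n : ℕ} → Partition n → Set
Classical {n} P = Σ (List (Hyp n)) (λ H → IsPart H P)

-- The strict weak order on {±1,…,±n}: -n < … < -2 < ±1 < 2 < … < n,
-- with 1 and -1 incomparable; 0 is ignored.

rank : {n : ℕ} → Λ n → ℕ
rank {n} (pos i) = n + toℕ i
rank {n} (neg i) = n ∸ suc (toℕ i)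
rank zer = 0

nonzero : {n : ℕ} → Λ n → Bool
nonzero zer = false
nonzero _   = true

isOne : {n : ℕ} → Λ n → Bool
isOne (pos i) = toℕ i ≡ᵇ 0
isOne _       = false

isMinusOne : {n : ℕ} → Λ n → Bool
isMinusOne (neg i) = toℕ i ≡ᵇ 0
isMinusOne _       = false

lt : {n : ℕ} → Λ n → Λ n → Bool
lt s t = nonzero s ∧ nonzero t ∧ (rank s <ᵇ rank t)
         ∧ not ((isMinusOne s ∧ isOne t) ∨ (isOne s ∧ isMinusOne t))

_≺_ : {n : ℕ} → Λ n → Λ n → Set
s ≺ t = lt s t ≡ true

Edge : {n : ℕ} → Partition n → Λ n → Λ n → Set
Edge {n} P s s' = (s ≺ s') × (P s s' ≡ true)
                × ((s'' : Λ n) → P s s'' ≡ true → s ≺ s'' → s'' ≺ s' → ⊥)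

NonNesting : {n : ℕ} → Partition n → Set
NonNesting {n} P = (a b c d : Λ n) → Edge P a d → Edge P b c
                   → a ≺ b → b ≺ c → c ≺ d → ⊥

ClassicalNonNesting : {n : ℕ} → Partition n → Set
ClassicalNonNesting P = Classical P × NonNesting P

-- Statistics. Positive elements are 2,…,n, i.e. pos i with toℕ i ≥ 1.

isPos : {n : ℕ} → Λ n → Bool
isPos (pos i) = 0 <ᵇ toℕ i
isPos _       = false

block : {n : ℕ} → Partition n → Λ n → List (Λ n)
block {n} P s = filterᵇ (P s) (allΛ n)

leastPos : {n : ℕ} → Partition n → Fin n → Bool
leastPos {n} P i = isPos (pos i)
  ∧ all (λ j → not (P (pos i) (pos j) ∧ isPos (pos j) ∧ (toℕ j <ᵇ toℕ i))) (allFin n)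

reps : {n : ℕ} → Partition n → List (Fin n)
reps {n} P = filterᵇ (leastPos P) (allFin n)

posNonSwitching : {n : ℕ} → Partition n → Fin n → Bool
posNonSwitching P i = all isPos (block P (pos i))

switching : {n : ℕ} → Partition n → Fin n → Bool
switching P i = any (λ t → not (isPos t)) (block P (pos i))

Mreps : {n : ℕ} → Partition n → List (Fin n)
Mreps P = filterᵇ (posNonSwitching P) (reps P)

Preps : {n : ℕ} → Partition n → List (Fin n)
Preps P = filterᵇ (switching P) (reps P)

hasOne : {n : ℕ} → Partition n → Fin n → Bool
hasOne {n} P i = any (λ t → isOne t ∨ isMinusOne t) (block P (pos i))

Rreps : {n : ℕ} → Partition n → List (Fin n)
Rreps P = filterᵇ (hasOne P) (reps P)

-- the integer value of pos i is i+1
aStat : {n : ℕ} → Partition n → List ℕ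
aStat P = map (λ i → suc (toℕ i)) (Mreps P)

μStat : {n : ℕ} → Partition n → List ℕ
μStat P = map (λ i → length (block P (pos i))) (Mreps P)

νStat : {n : ℕ} → Partition n → List ℕ
νStat P = map (λ i → length (filterᵇ isPos (block P (pos i)))) (Preps P)

-- R ∩ {1,-1} encoded as (1 ∈ R , -1 ∈ R)
cStat : {n : ℕ} → Partition n → List (Bool × Bool)
cStat P = map (λ i → any isOne (block P (pos i)) , any isMinusOne (block P (pos i))) (Rreps P)

-- Positive elements 2,…,n are
-- handled from left to right: the least elements of the positive nonswitching blocks are
-- listed by a; no edge between positive elements ends before the least positive element of
-- a switching block, so the length of ν decides whether j opens a switching block;
-- otherwise, by nonnesting, j joins the open block with the smallest last element, and
-- which blocks are still open is read off from the sizes in μ and ν.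
--
-- The switching blocks meeting ±1 are those with the largest least positive elements, so
-- they are determined by the length of c, and c says whether they meet 1 or -1. Every
-- other switching block is paired with the block of its negatives; nonnesting makes this
-- pairing order-reversing, and a descent shows that two partitions with equal statistics
-- pair alike. The zero block is then determined, since in type D it contains at least two
-- pairs ±i.

module Submission where

open import Defs
open import Data.Bool using (Bool; true; false; _∧_; _∨_; not; if_then_else_)
open import Data.Bool.Properties
  using (T?; _≟_; T-≡; ¬-not; ∧-conicalˡ; ∧-conicalʳ; ∧-zeroʳ; ∨-identityʳ; not-involutive)
open import Data.Bool.ListAction using (all; any)
open import Data.Empty using (⊥; ⊥-elim)
open import Data.Fin using (Fin; toℕ)
open import Data.Fin.Properties using (toℕ-injective; toℕ<n; any?) renaming (_≟_ to _≟ᶠ_)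
open import Data.Integer using (+_; -[1+_])
open import Data.List using (List; []; _∷_; map; allFin; filterᵇ; length)
open import Data.List.Membership.Propositional using (_∈_; find; lose)
open import Data.List.Membership.Propositional.Properties
  using (∈-filter⁺; ∈-filter⁻; ∈-map⁺; ∈-++⁺ˡ; ∈-++⁺ʳ; ∈-allFin)
open import Data.List.Properties using (∷-injective; map-injective; length-map; filter-all)
open import Data.List.Relation.Unary.All as All using (All)
open import Data.List.Relation.Unary.AllPairs using (AllPairs; _∷_)
open import Data.List.Relation.Unary.AllPairs.Properties using (tabulate⁺-<)
open import Data.List.Relation.Unary.Any using (here; there)
open import Data.List.Relation.Unary.Any.Properties using (any⁺; any⁻)
open import Data.Nat using (ℕ; zero; suc; _+_; _∸_; _<ᵇ_; _≡ᵇ_; _<_; _≤_; z≤n; s≤s; z<s)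
open import Data.Nat.Induction using (<-wellFounded)
open import Data.Nat.Properties
  using ( <-cmp; <-irrefl; <-trans; ≤-trans; <-≤-trans; ≤-<-trans; <⇒≤; <⇒≱; ≮⇒≥
        ; m≤m+n; m≤n⇒m≤1+n; m<1+n⇒m<n∨m≡n; m≤n⇒m<n∨m≡n; suc-injective
        ; +-cancelˡ-<; +-monoʳ-<; ∸-monoʳ-<; ∸-monoʳ-≤; ∸-monoˡ-<
        ; <ᵇ⇒<; <⇒<ᵇ; ≡ᵇ⇒≡; ≡⇒≡ᵇ )
open import Data.Product using (∃; _×_; _,_; proj₁; proj₂)
open import Data.Rational using (ℚ; 0ℚ; 1ℚ; -_; mkℚ; ↥_)
open import Data.Rational.Properties using (↥p≡0⇒p≡0; 1≢0)
open import Data.Sum using (_⊎_; inj₁; inj₂)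
open import Function using (_∘_)
open import Function.Bundles using (Equivalence)
open import Induction.WellFounded using (Acc; acc)
open import Relation.Binary using (tri<; tri≈; tri>)
open import Relation.Binary.PropositionalEquality
open import Relation.Nullary using (¬_; yes; no; does)
open import Relation.Nullary.Decidable using (¬?; _×-dec_)

bool-ext : ∀ {a b : Bool} → (a ≡ true → b ≡ true) → (b ≡ true → a ≡ true) → a ≡ b
bool-ext {false} {false} f g = refl
bool-ext {false} {true}  f g = g refl
bool-ext {true}  {false} f g = sym (f refl)
bool-ext {true}  {true}  f g = refl

∧-intro : ∀ {a b} → a ≡ true → b ≡ true → a ∧ b ≡ true
∧-intro refl refl = refl

false≢true : ∀ {a} → a ≡ false → a ≡ true → ⊥
false≢true refl ()

<ᵇ⇒<′ : ∀ {m k} → (m <ᵇ k) ≡ true → m < k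
<ᵇ⇒<′ {m} {k} e = <ᵇ⇒< m k (Equivalence.from T-≡ e)

<⇒<ᵇ′ : ∀ {m k} → m < k → (m <ᵇ k) ≡ true
<⇒<ᵇ′ p = Equivalence.to T-≡ (<⇒<ᵇ p)

≡ᵇ⇒≡′ : ∀ {m k} → (m ≡ᵇ k) ≡ true → m ≡ k
≡ᵇ⇒≡′ {m} {k} e = ≡ᵇ⇒≡ m k (Equivalence.from T-≡ e)

≡⇒≡ᵇ′ : ∀ {m k} → m ≡ k → (m ≡ᵇ k) ≡ true
≡⇒≡ᵇ′ {m} {k} p = Equivalence.to T-≡ (≡⇒≡ᵇ m k p)

¬isPos⇒≡0 : {n : ℕ} {k : Fin n} → isPos (pos k) ≡ false → toℕ k ≡ 0
¬isPos⇒≡0 {k = k} e with toℕ k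
... | zero = refl

zero⊎positive : (m : ℕ) → m ≡ 0 ⊎ 0 < m
zero⊎positive zero    = inj₁ refl
zero⊎positive (suc m) = inj₂ z<s

module _ {A : Set} where

  ∈-filterᵇ⁺ : (p : A → Bool) {x : A} {xs : List A} → x ∈ xs → p x ≡ true → x ∈ filterᵇ p xs
  ∈-filterᵇ⁺ p x∈xs px = ∈-filter⁺ (T? ∘ p) x∈xs (Equivalence.from T-≡ px)

  ∈-filterᵇ⁻ : (p : A → Bool) {x : A} (xs : List A) → x ∈ filterᵇ p xs → x ∈ xs × p x ≡ true
  ∈-filterᵇ⁻ p xs x∈ with ∈-filter⁻ (T? ∘ p) {xs = xs} x∈
  ... | x∈xs , px = x∈xs , Equivalence.to T-≡ px

  any-intro : (p : A → Bool) {x : A} {xs : List A} → x ∈ xs → p x ≡ true → any p xs ≡ true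
  any-intro p x∈xs px = Equivalence.to T-≡ (any⁺ p (lose x∈xs (Equivalence.from T-≡ px)))

  any-witness : (p : A → Bool) (xs : List A) → any p xs ≡ true → ∃ λ x → x ∈ xs × p x ≡ true
  any-witness p xs e with find (any⁻ p xs (Equivalence.from T-≡ e))
  ... | x , x∈xs , px = x , x∈xs , Equivalence.to T-≡ px

  all-elim : (p : A → Bool) {x : A} (xs : List A) → all p xs ≡ true → x ∈ xs → p x ≡ true
  all-elim p (y ∷ ys) e (here refl) = ∧-conicalˡ (p y) _ e
  all-elim p (y ∷ ys) e (there x∈) = all-elim p ys (∧-conicalʳ (p y) _ e) x∈

  all-intro : (p : A → Bool) (xs : List A) → (∀ x → x ∈ xs → p x ≡ true) → all p xs ≡ true
  all-intro p []       h = refl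
  all-intro p (y ∷ ys) h = ∧-intro (h y (here refl)) (all-intro p ys (λ x x∈ → h x (there x∈)))

  all≡not-any-not : (p : A → Bool) (xs : List A) → all p xs ≡ not (any (not ∘ p) xs)
  all≡not-any-not p []       = refl
  all≡not-any-not p (y ∷ ys) with p y
  ... | true  = all≡not-any-not p ys
  ... | false = refl

  filterᵇ-filterᵇ : (p q : A → Bool) (xs : List A)
                  → filterᵇ q (filterᵇ p xs) ≡ filterᵇ (λ x → p x ∧ q x) xs
  filterᵇ-filterᵇ p q []       = refl
  filterᵇ-filterᵇ p q (y ∷ ys) with p y
  ... | false = filterᵇ-filterᵇ p q ys
  ... | true with q y
  ...   | true  = cong (y ∷_) (filterᵇ-filterᵇ p q ys)
  ...   | false = filterᵇ-filterᵇ p q ys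

  filterᵇ-cong : {p q : A → Bool} (xs : List A) → (∀ x → p x ≡ q x) → filterᵇ p xs ≡ filterᵇ q xs
  filterᵇ-cong {p} {q} [] h = refl
  filterᵇ-cong {p} {q} (y ∷ ys) h rewrite h y with q y
  ... | true  = cong (y ∷_) (filterᵇ-cong ys h)
  ... | false = filterᵇ-cong ys h

  filterᵇ-injective-on : {p q : A → Bool} (xs : List A) → filterᵇ p xs ≡ filterᵇ q xs
                       → {x : A} → x ∈ xs → p x ≡ q x
  filterᵇ-injective-on {p} {q} xs e {x} x∈xs = bool-ext
    (λ px → proj₂ (∈-filterᵇ⁻ q xs (subst (x ∈_) e (∈-filterᵇ⁺ p x∈xs px))))
    (λ qx → proj₂ (∈-filterᵇ⁻ p xs (subst (x ∈_) (sym e) (∈-filterᵇ⁺ q x∈xs qx))))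

  map-injective-on : {B : Set} {f g : A → B} (xs : List A) → map f xs ≡ map g xs
                   → {x : A} → x ∈ xs → f x ≡ g x
  map-injective-on (y ∷ ys) e (here refl) = proj₁ (∷-injective e)
  map-injective-on (y ∷ ys) e (there x∈) = map-injective-on ys (proj₂ (∷-injective e)) x∈

  length-filterᵇ-mono : (p q : A → Bool) (xs : List A) → (∀ x → p x ≡ true → q x ≡ true)
                      → length (filterᵇ p xs) ≤ length (filterᵇ q xs)
  length-filterᵇ-mono p q []       h = z≤n
  length-filterᵇ-mono p q (y ∷ ys) h with p y in py | q y in qy
  ... | true  | true  = s≤s (length-filterᵇ-mono p q ys h)
  ... | true  | false = ⊥-elim (false≢true qy (h y py))
  ... | false | true  = m≤n⇒m≤1+n (length-filterᵇ-mono p q ys h)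
  ... | false | false = length-filterᵇ-mono p q ys h

  length-filterᵇ-< : (p q : A → Bool) (xs : List A) → (∀ x → p x ≡ true → q x ≡ true)
                   → {x : A} → x ∈ xs → p x ≡ false → q x ≡ true
                   → length (filterᵇ p xs) < length (filterᵇ q xs)
  length-filterᵇ-< p q (y ∷ ys) h (here refl) px qx rewrite px | qx = s≤s (length-filterᵇ-mono p q ys h)
  length-filterᵇ-< p q (y ∷ ys) h (there x∈) px qx with p y in py | q y in qy
  ... | true  | true  = s≤s (length-filterᵇ-< p q ys h x∈ px qx)
  ... | true  | false = ⊥-elim (false≢true qy (h y py))
  ... | false | true  = m≤n⇒m≤1+n (length-filterᵇ-< p q ys h x∈ px qx)
  ... | false | false = length-filterᵇ-< p q ys h x∈ px qx

module _ {n : ℕ} where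

  allFin-increasing : AllPairs (λ i j → toℕ i < toℕ j) (allFin n)
  allFin-increasing = tabulate⁺-< (λ i<j → i<j)

  -- In an increasing list, x has the same position among the elements satisfying p as
  -- among those satisfying q, since p and q agree below x.
  map-filterᵇ-aligned : {B : Set} (p q : Fin n → Bool) (f g : Fin n → B) (xs : List (Fin n))
    → AllPairs (λ i j → toℕ i < toℕ j) xs
    → {x : Fin n} → x ∈ xs → p x ≡ true → q x ≡ true → (∀ y → toℕ y < toℕ x → p y ≡ q y)
    → map f (filterᵇ p xs) ≡ map g (filterᵇ q xs) → f x ≡ g x
  map-filterᵇ-aligned p q f g (y ∷ ys) inc (here refl) px qx agree e rewrite px | qx = proj₁ (∷-injective e)
  map-filterᵇ-aligned p q f g (y ∷ ys) (y< ∷ inc) {x} (there x∈) px qx agree e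
    with p y | q y | agree y (All.lookup y< x∈)
  ... | true  | true  | _ = map-filterᵇ-aligned p q f g ys inc x∈ px qx agree (proj₂ (∷-injective e))
  ... | false | false | _ = map-filterᵇ-aligned p q f g ys inc x∈ px qx agree e
  ... | true  | false | ()
  ... | false | true  | ()

-- The order ≺

module _ {n : ℕ} where

  -- lt is not injective, so the endpoints of ≺ usually have to be supplied explicitly.
  data _⊏_ : Λ n → Λ n → Set where
    pos<pos : ∀ {i j} → toℕ i < toℕ j → pos i ⊏ pos j
    neg<neg : ∀ {i j} → toℕ j < toℕ i → neg i ⊏ neg j
    neg<pos : ∀ {i j} → 0 < toℕ i ⊎ 0 < toℕ j → neg i ⊏ pos j

  private
    rank-neg< : (i : Fin n) → n ∸ suc (toℕ i) < n
    rank-neg< i = ∸-monoʳ-< {n} {suc (toℕ i)} {0} z<s (toℕ<n i)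

    rank-neg-reflects : (i j : Fin n) → n ∸ suc (toℕ i) < n ∸ suc (toℕ j) → toℕ j < toℕ i
    rank-neg-reflects i j p with <-cmp (toℕ j) (toℕ i)
    ... | tri< j<i _ _ = j<i
    ... | tri≈ _ j≡i _ rewrite j≡i = ⊥-elim (<-irrefl refl p)
    ... | tri> _ _ i<j = ⊥-elim (<⇒≱ p (∸-monoʳ-≤ n (s≤s (<⇒≤ i<j))))

    not-both-one : (a b : ℕ) → not (((a ≡ᵇ 0) ∧ (b ≡ᵇ 0)) ∨ false) ≡ true → 0 < a ⊎ 0 < b
    not-both-one zero    zero    ()
    not-both-one zero    (suc b) _ = inj₂ z<s
    not-both-one (suc a) b       _ = inj₁ z<s

    one-not-both : (a b : ℕ) → 0 < a ⊎ 0 < b → not ((a ≡ᵇ 0) ∧ (b ≡ᵇ 0)) ≡ true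
    one-not-both zero    zero    (inj₁ ())
    one-not-both zero    zero    (inj₂ ())
    one-not-both zero    (suc b) _ = refl
    one-not-both (suc a) b       _ = refl

  ≺⇒⊏ : {s t : Λ n} → s ≺ t → s ⊏ t
  ≺⇒⊏ {pos i} {pos j} e = pos<pos (+-cancelˡ-< n (toℕ i) (toℕ j) (<ᵇ⇒<′ (∧-conicalˡ _ _ e)))
  ≺⇒⊏ {pos i} {neg j} e =
    ⊥-elim (<⇒≱ (<ᵇ⇒<′ (∧-conicalˡ _ _ e)) (≤-trans (<⇒≤ (rank-neg< j)) (m≤m+n n (toℕ i))))
  ≺⇒⊏ {neg i} {pos j} e =
    neg<pos (not-both-one (toℕ i) (toℕ j) (∧-conicalʳ (n ∸ suc (toℕ i) <ᵇ n + toℕ j) _ e))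
  ≺⇒⊏ {neg i} {neg j} e = neg<neg (rank-neg-reflects i j (<ᵇ⇒<′ (∧-conicalˡ _ _ e)))

  ⊏⇒≺ : {s t : Λ n} → s ⊏ t → s ≺ t
  ⊏⇒≺ {pos i} {pos j} (pos<pos p) rewrite ∧-zeroʳ (toℕ i ≡ᵇ 0) =
    ∧-intro (<⇒<ᵇ′ (+-monoʳ-< n p)) refl
  ⊏⇒≺ {neg i} {neg j} (neg<neg p) rewrite ∧-zeroʳ (toℕ i ≡ᵇ 0) =
    ∧-intro (<⇒<ᵇ′ (∸-monoʳ-< (s≤s p) (toℕ<n i))) refl
  ⊏⇒≺ {neg i} {pos j} (neg<pos p) rewrite ∨-identityʳ ((toℕ i ≡ᵇ 0) ∧ (toℕ j ≡ᵇ 0)) =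
    ∧-intro (<⇒<ᵇ′ (<-≤-trans (rank-neg< i) (m≤m+n n (toℕ j)))) (one-not-both (toℕ i) (toℕ j) p)

  ⊏-trans : {s t u : Λ n} → s ⊏ t → t ⊏ u → s ⊏ u
  ⊏-trans (pos<pos p) (pos<pos q) = pos<pos (<-trans p q)
  ⊏-trans (neg<neg p) (neg<neg q) = neg<neg (<-trans q p)
  ⊏-trans (neg<neg p) (neg<pos _) = neg<pos (inj₁ (≤-<-trans z≤n p))
  ⊏-trans (neg<pos _) (pos<pos q) = neg<pos (inj₂ (≤-<-trans z≤n q))

  ≺-trans : {s t u : Λ n} → s ≺ t → t ≺ u → s ≺ u
  ≺-trans {s} {t} {u} p q = ⊏⇒≺ (⊏-trans (≺⇒⊏ {s} {t} p) (≺⇒⊏ {t} {u} q))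

  pos≺⇒pos : {i : Fin n} {s : Λ n} → pos i ≺ s → ∃ λ j → s ≡ pos j × toℕ i < toℕ j
  pos≺⇒pos {i} {s} i≺s with ≺⇒⊏ {s = pos i} {t = s} i≺s
  ... | pos<pos i<j = _ , refl , i<j

  pos≺pos⇒< : {i j : Fin n} → pos i ≺ pos j → toℕ i < toℕ j
  pos≺pos⇒< {i} {j} i≺j with ≺⇒⊏ {s = pos i} {t = pos j} i≺j
  ... | pos<pos i<j = i<j

  positive-at-or-above : {i : Fin n} {s : Λ n} → 0 < toℕ i → s ≡ pos i ⊎ pos i ≺ s
                       → ∃ λ j → s ≡ pos j × 0 < toℕ j
  positive-at-or-above 0<i (inj₁ refl) = _ , refl , 0<i
  positive-at-or-above {s = s} 0<i (inj₂ i≺s) with pos≺⇒pos {s = s} i≺s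
  ... | j , refl , i<j = j , refl , <-trans 0<i i<j

  rank-mono : {s t : Λ n} → s ≺ t → rank s < rank t
  rank-mono {s} {t} e = <ᵇ⇒<′ (∧-conicalˡ _ _ (∧-conicalʳ (nonzero t) _ (∧-conicalʳ (nonzero s) _ e)))

-- Elements of Λ and blocks

allΛ-complete : {n : ℕ} (s : Λ n) → s ∈ allΛ n
allΛ-complete {n} (pos i) = ∈-++⁺ˡ (∈-map⁺ pos (∈-allFin i))
allΛ-complete {n} (neg i) = ∈-++⁺ʳ (map pos (allFin n)) (∈-++⁺ˡ (∈-map⁺ neg (∈-allFin i)))
allΛ-complete {n} zer     = ∈-++⁺ʳ (map pos (allFin n)) (∈-++⁺ʳ (map neg (allFin n)) (here refl))

negΛ : {n : ℕ} → Λ n → Λ n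
negΛ (pos i) = neg i
negΛ (neg i) = pos i
negΛ zer     = zer

negΛ-involutive : {n : ℕ} (s : Λ n) → negΛ (negΛ s) ≡ s
negΛ-involutive (pos i) = refl
negΛ-involutive (neg i) = refl
negΛ-involutive zer     = refl

neg-involutive : (p : ℚ) → - (- p) ≡ p
neg-involutive (mkℚ (+ zero)  _ _) = refl
neg-involutive (mkℚ (+ suc m) _ _) = refl
neg-involutive (mkℚ -[1+ m ]  _ _) = refl

p≡-p⇒p≡0 : (p : ℚ) → p ≡ - p → p ≡ 0ℚ
p≡-p⇒p≡0 p@(mkℚ (+ zero) _ _) _ = ↥p≡0⇒p≡0 p refl
p≡-p⇒p≡0 (mkℚ (+ suc m) _ _) e with cong ↥_ e
... | ()
p≡-p⇒p≡0 (mkℚ -[1+ m ] _ _) e with cong ↥_ e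
... | ()

coord-negΛ : {n : ℕ} (x : Pt n) (s : Λ n) → coord x (negΛ s) ≡ - coord x s
coord-negΛ x (pos i) = refl
coord-negΛ x (neg i) = sym (neg-involutive (x i))
coord-negΛ x zer     = refl

∧₃-elim : ∀ {a b c} → a ∧ b ∧ c ≡ true → a ≡ true × b ≡ true × c ≡ true
∧₃-elim {true} {true} {true} _ = refl , refl , refl

data ±One {n : ℕ} : Λ n → Set where
  plus-one  : ∀ {k} → toℕ k ≡ 0 → ±One (pos k)
  minus-one : ∀ {k} → toℕ k ≡ 0 → ±One (neg k)

isOne∨isMinusOne⇒±One : {n : ℕ} (t : Λ n) → (isOne t ∨ isMinusOne t) ≡ true → ±One t
isOne∨isMinusOne⇒±One (pos k) e = plus-one (≡ᵇ⇒≡′ (trans (sym (∨-identityʳ (toℕ k ≡ᵇ 0))) e))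
isOne∨isMinusOne⇒±One (neg k) e = minus-one (≡ᵇ⇒≡′ e)

±One⇒isOne∨isMinusOne : {n : ℕ} {t : Λ n} → ±One t → (isOne t ∨ isMinusOne t) ≡ true
±One⇒isOne∨isMinusOne (plus-one  {k} e) rewrite e = refl
±One⇒isOne∨isMinusOne (minus-one {k} e) rewrite e = refl

±One-negΛ : {n : ℕ} {t : Λ n} → ±One t → ±One (negΛ t)
±One-negΛ (plus-one e)  = minus-one e
±One-negΛ (minus-one e) = plus-one e

±One⇒¬isPos : {n : ℕ} {t : Λ n} → ±One t → isPos t ≡ false
±One⇒¬isPos (plus-one e) rewrite e = refl
±One⇒¬isPos (minus-one e) = refl

-- zer is excluded: it lies outside the order ≺.
data Nonpositive {n : ℕ} : Λ n → Set where
  negative : ∀ k → Nonpositive (neg k)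
  one      : ∀ {k} → toℕ k ≡ 0 → Nonpositive (pos k)

module _ {n : ℕ} where

  isOne⇒≡pos : {t : Λ n} {k : Fin n} → toℕ k ≡ 0 → isOne t ≡ true → t ≡ pos k
  isOne⇒≡pos {pos i} k≡0 e = cong pos (toℕ-injective (trans (≡ᵇ⇒≡′ e) (sym k≡0)))

  isMinusOne⇒≡neg : {t : Λ n} {k : Fin n} → toℕ k ≡ 0 → isMinusOne t ≡ true → t ≡ neg k
  isMinusOne⇒≡neg {neg i} k≡0 e = cong neg (toℕ-injective (trans (≡ᵇ⇒≡′ e) (sym k≡0)))

  ±One⇒Nonpositive : {y : Λ n} → ±One y → Nonpositive y
  ±One⇒Nonpositive (plus-one e)        = one e
  ±One⇒Nonpositive (minus-one {k} _)   = negative k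

  Nonpositive⇒≺positive : {x : Λ n} {w : Fin n} → Nonpositive x → 0 < toℕ w → x ≺ pos w
  Nonpositive⇒≺positive (negative k) 0<w = ⊏⇒≺ (neg<pos (inj₂ 0<w))
  Nonpositive⇒≺positive (one e)      0<w = ⊏⇒≺ (pos<pos (subst (_< _) (sym e) 0<w))

  ±One-maximal : {y x : Λ n} → ±One y → Nonpositive x → ¬ y ≺ x
  ±One-maximal {y} {x} ±y x≤0 y≺x with ≺⇒⊏ {s = y} {t = x} y≺x | ±y | x≤0
  ... | pos<pos p        | plus-one _  | one e       = <-irrefl (sym e) (≤-<-trans z≤n p)
  ... | neg<neg p        | minus-one e | _           = <-irrefl refl (≤-<-trans z≤n (subst (_ <_) e p))
  ... | neg<pos (inj₁ p) | minus-one e | _           = <-irrefl (sym e) p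
  ... | neg<pos (inj₂ p) | minus-one _ | one e       = <-irrefl (sym e) p

  neg≺±One : {k : Fin n} {y : Λ n} → 0 < toℕ k → ±One y → neg k ≺ y
  neg≺±One 0<k (plus-one _)  = ⊏⇒≺ (neg<pos (inj₁ 0<k))
  neg≺±One 0<k (minus-one e) = ⊏⇒≺ (neg<neg (subst (_< _) (sym e) 0<k))

module _ {n : ℕ} (P : Partition n) where

  leastPos-positive : ∀ {i} → leastPos P i ≡ true → 0 < toℕ i
  leastPos-positive {i} e = <ᵇ⇒<′ (∧-conicalˡ (isPos (pos i)) _ e)

  leastPos-least : ∀ {i j} → leastPos P i ≡ true → P (pos i) (pos j) ≡ true
                 → 0 < toℕ j → toℕ j < toℕ i → ⊥
  leastPos-least {i} {j} e i∼j 0<j j<i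
    with all-elim _ (allFin n) (∧-conicalʳ (isPos (pos i)) _ e) (∈-allFin j)
  ... | r rewrite i∼j | <⇒<ᵇ′ 0<j | <⇒<ᵇ′ j<i = false≢true refl r

  private
    smaller-in-block : Fin n → Fin n → Bool
    smaller-in-block i j = P (pos i) (pos j) ∧ isPos (pos j) ∧ (toℕ j <ᵇ toℕ i)

  leastPos-intro : ∀ {i} → 0 < toℕ i
                 → (∀ j → P (pos i) (pos j) ≡ true → 0 < toℕ j → toℕ j < toℕ i → ⊥)
                 → leastPos P i ≡ true
  leastPos-intro {i} 0<i least = ∧-intro (<⇒<ᵇ′ 0<i) (all-intro _ (allFin n) not-smaller)
    where
      not-smaller : ∀ j → j ∈ allFin n → not (smaller-in-block i j) ≡ true
      not-smaller j _ with smaller-in-block i j in eq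
      ... | false = refl
      ... | true with ∧₃-elim {P (pos i) (pos j)} {isPos (pos j)} eq
      ...   | i∼j , 0<j , j<i = ⊥-elim (least j i∼j (<ᵇ⇒<′ 0<j) (<ᵇ⇒<′ j<i))

  leastPos-or-smaller : (i : Fin n) → 0 < toℕ i
    → leastPos P i ≡ true ⊎ ∃ λ j → P (pos i) (pos j) ≡ true × 0 < toℕ j × toℕ j < toℕ i
  leastPos-or-smaller i 0<i with any (smaller-in-block i) (allFin n) in eq
  ... | true with any-witness (smaller-in-block i) (allFin n) eq
  ...   | j , _ , smaller with ∧₃-elim {P (pos i) (pos j)} {isPos (pos j)} smaller
  ...     | i∼j , 0<j , j<i = inj₂ (j , i∼j , <ᵇ⇒<′ 0<j , <ᵇ⇒<′ j<i)
  leastPos-or-smaller i 0<i | false = inj₁ (leastPos-intro 0<i λ j i∼j 0<j j<i →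
    false≢true eq (any-intro (smaller-in-block i) (∈-allFin j)
                             (∧-intro i∼j (∧-intro (<⇒<ᵇ′ 0<j) (<⇒<ᵇ′ j<i)))))

  block-any-witness : (f : Λ n → Bool) (s : Λ n) → any f (block P s) ≡ true
                    → ∃ λ t → P s t ≡ true × f t ≡ true
  block-any-witness f s e with any-witness f (block P s) e
  ... | t , t∈ , ft = t , proj₂ (∈-filterᵇ⁻ (P s) (allΛ n) t∈) , ft

  block-any-intro : (f : Λ n → Bool) {s : Λ n} (t : Λ n) → P s t ≡ true → f t ≡ true
                  → any f (block P s) ≡ true
  block-any-intro f t s∼t ft = any-intro f (∈-filterᵇ⁺ _ (allΛ-complete t) s∼t) ft

  switching-witness : ∀ {i} → switching P i ≡ true → ∃ λ t → P (pos i) t ≡ true × isPos t ≡ false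
  switching-witness {i} e with block-any-witness (not ∘ isPos) (pos i) e
  ... | t , i∼t , nonpos = t , i∼t , trans (sym (not-involutive (isPos t))) (cong not nonpos)

  switching-intro : ∀ {i} (t : Λ n) → P (pos i) t ≡ true → isPos t ≡ false → switching P i ≡ true
  switching-intro t i∼t nonpos = block-any-intro (not ∘ isPos) t i∼t (cong not nonpos)

  switching≡not-posNonSwitching : (i : Fin n) → switching P i ≡ not (posNonSwitching P i)
  switching≡not-posNonSwitching i =
    trans (sym (not-involutive _)) (cong not (sym (all≡not-any-not isPos (block P (pos i)))))

  hasOne-witness : ∀ {i} → hasOne P i ≡ true → ∃ λ t → P (pos i) t ≡ true × ±One t
  hasOne-witness {i} e with block-any-witness (λ t → isOne t ∨ isMinusOne t) (pos i) e
  ... | t , i∼t , one± = t , i∼t , isOne∨isMinusOne⇒±One t one±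

  hasOne-intro : ∀ {i t} → P (pos i) t ≡ true → ±One t → hasOne P i ≡ true
  hasOne-intro {t = t} i∼t ±t =
    block-any-intro (λ t → isOne t ∨ isMinusOne t) t i∼t (±One⇒isOne∨isMinusOne ±t)

  hasOne⇒switching : ∀ {i} → hasOne P i ≡ true → switching P i ≡ true
  hasOne⇒switching e with hasOne-witness e
  ... | t , i∼t , ±t = switching-intro t i∼t (±One⇒¬isPos ±t)

  isMrep isPrep isRrep : Fin n → Bool
  isMrep i = leastPos P i ∧ posNonSwitching P i
  isPrep i = leastPos P i ∧ switching P i
  isRrep i = leastPos P i ∧ hasOne P i

  Mreps≡ : Mreps P ≡ filterᵇ isMrep (allFin n)
  Mreps≡ = filterᵇ-filterᵇ (leastPos P) (posNonSwitching P) (allFin n)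

  Preps≡ : Preps P ≡ filterᵇ isPrep (allFin n)
  Preps≡ = filterᵇ-filterᵇ (leastPos P) (switching P) (allFin n)

  Rreps≡ : Rreps P ≡ filterᵇ isRrep (allFin n)
  Rreps≡ = filterᵇ-filterᵇ (leastPos P) (hasOne P) (allFin n)

  isPrep≡ : ∀ i → isPrep i ≡ leastPos P i ∧ not (isMrep i)
  isPrep≡ i with leastPos P i
  ... | false = refl
  ... | true  = switching≡not-posNonSwitching i

  positiveCount : Fin n → ℕ
  positiveCount i = length (filterᵇ isPos (block P (pos i)))

  positiveCount≡ : ∀ i → positiveCount i ≡ length (filterᵇ (λ x → P (pos i) x ∧ isPos x) (allΛ n))
  positiveCount≡ i = cong length (filterᵇ-filterᵇ (P (pos i)) isPos (allΛ n))

  posNonSwitching⇒positiveCount≡size : ∀ {i} → posNonSwitching P i ≡ true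
                                     → positiveCount i ≡ length (block P (pos i))
  posNonSwitching⇒positiveCount≡size {i} e = cong length (filter-all (T? ∘ isPos)
    (All.tabulate λ {x} x∈ → Equivalence.from T-≡ (all-elim isPos (block P (pos i)) e x∈)))

leastPos-local : {n : ℕ} (P Q : Partition n) {r : Fin n}
  → (∀ j → 0 < toℕ j → toℕ j < toℕ r → P (pos r) (pos j) ≡ Q (pos r) (pos j))
  → leastPos P r ≡ leastPos Q r
leastPos-local P Q {r} agree = bool-ext
  (λ least → leastPos-intro Q (leastPos-positive P least) λ j r∼j 0<j j<r →
    leastPos-least P least (trans (agree j 0<j j<r) r∼j) 0<j j<r)
  (λ least → leastPos-intro P (leastPos-positive Q least) λ j r∼j 0<j j<r →
    leastPos-least Q least (trans (sym (agree j 0<j j<r)) r∼j) 0<j j<r)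

-- Classical partitions

module ClassicalPartition {n : ℕ} {P : Partition n} (classical : Classical P) where

  private
    H = proj₁ classical

    sound : ∀ {s t} → P s t ≡ true → (x : Pt n) → InL H x → coord x s ≡ coord x t
    sound {s} {t} = Equivalence.to (proj₂ classical s t)

    complete : ∀ s t → ((x : Pt n) → InL H x → coord x s ≡ coord x t) → P s t ≡ true
    complete s t = Equivalence.from (proj₂ classical s t)

  ∼-refl : ∀ s → P s s ≡ true
  ∼-refl s = complete s s (λ _ _ → refl)

  ∼-sym : ∀ {s t} → P s t ≡ true → P t s ≡ true
  ∼-sym {s} {t} e = complete t s (λ x x∈L → sym (sound e x x∈L))

  ∼-trans : ∀ {s t u} → P s t ≡ true → P t u ≡ true → P s u ≡ true
  ∼-trans {s} {t} {u} e f = complete s u (λ x x∈L → trans (sound e x x∈L) (sound f x x∈L))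

  ∼-neg : ∀ {s t} → P s t ≡ true → P (negΛ s) (negΛ t) ≡ true
  ∼-neg {s} {t} e = complete (negΛ s) (negΛ t) λ x x∈L → begin
    coord x (negΛ s) ≡⟨ coord-negΛ x s ⟩
    - coord x s      ≡⟨ cong -_ (sound e x x∈L) ⟩
    - coord x t      ≡⟨ coord-negΛ x t ⟨
    coord x (negΛ t) ∎
    where open ≡-Reasoning

  ∼-comm : ∀ s t → P s t ≡ P t s
  ∼-comm s t = bool-ext ∼-sym ∼-sym

  ∼-neg⁻ : ∀ {s t} → P (negΛ s) (negΛ t) ≡ true → P s t ≡ true
  ∼-neg⁻ {s} {t} e = subst₂ (λ a b → P a b ≡ true) (negΛ-involutive s) (negΛ-involutive t) (∼-neg e)

  ±-pair⇒zero : ∀ {i} → P (pos i) (neg i) ≡ true → P zer (pos i) ≡ true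
  ±-pair⇒zero {i} e = complete zer (pos i) (λ x x∈L → sym (p≡-p⇒p≡0 (x i) (sound e x x∈L)))

  zero⇒±-pair : ∀ {i} → P zer (pos i) ≡ true → P (pos i) (neg i) ≡ true
  zero⇒±-pair e = ∼-trans (∼-sym e) (∼-neg e)

  private
    indicator : Fin n → Pt n
    indicator i₀ k = if does (k ≟ᶠ i₀) then 1ℚ else 0ℚ

    indicator-≢ : ∀ {i₀ k} → k ≢ i₀ → indicator i₀ k ≡ 0ℚ
    indicator-≢ {i₀} {k} k≢i₀ with k ≟ᶠ i₀
    ... | yes k≡i₀ = ⊥-elim (k≢i₀ k≡i₀)
    ... | no  _    = refl

    indicator-self : ∀ i₀ → indicator i₀ i₀ ≡ 1ℚ
    indicator-self i₀ with i₀ ≟ᶠ i₀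
    ... | yes _  = refl
    ... | no  ne = ⊥-elim (ne refl)

  -- This is where D_n differs from B_n: if zer met a single pair ±i₀, the indicator
  -- vector of i₀ would lie on every hyperplane of H.
  zero-block-has-two : (i₀ : Fin n) → P zer (pos i₀) ≡ true → ∃ λ j → j ≢ i₀ × P zer (pos j) ≡ true
  zero-block-has-two i₀ z∼i₀ with any? (λ j → ¬? (j ≟ᶠ i₀) ×-dec (P zer (pos j) ≟ true))
  ... | yes found = found
  ... | no none = ⊥-elim (1≢0 (sym (trans (sound z∼i₀ (indicator i₀) indicator∈L) (indicator-self i₀))))
    where
      only-i₀ : ∀ j → P zer (pos j) ≡ true → j ≡ i₀
      only-i₀ j z∼j with j ≟ᶠ i₀
      ... | yes j≡i₀ = j≡i₀
      ... | no  j≢i₀ = ⊥-elim (none (j , j≢i₀ , z∼j))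

      on-hyperplane : ∀ h → h ∈ H → OnHyp (indicator i₀) h
      on-hyperplane (hEq i j i≢j) h∈H = trans (indicator-≢ i≢i₀) (sym (indicator-≢ j≢i₀))
        where
          i∼j : P (pos i) (pos j) ≡ true
          i∼j = complete (pos i) (pos j) (λ x x∈L → All.lookup x∈L h∈H)
          i≢i₀ : i ≢ i₀
          i≢i₀ refl = i≢j (sym (only-i₀ j (∼-trans z∼i₀ i∼j)))
          j≢i₀ : j ≢ i₀
          j≢i₀ refl = i≢j (only-i₀ i (∼-trans z∼i₀ (∼-sym i∼j)))
      on-hyperplane (hOpp i j i≢j) h∈H = trans (indicator-≢ i≢i₀) (sym (cong -_ (indicator-≢ j≢i₀)))
        where
          i∼-j : P (pos i) (neg j) ≡ true
          i∼-j = complete (pos i) (neg j) (λ x x∈L → All.lookup x∈L h∈H)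
          i≢i₀ : i ≢ i₀
          i≢i₀ refl = i≢j (sym (only-i₀ j (∼-neg (∼-trans z∼i₀ i∼-j))))
          j≢i₀ : j ≢ i₀
          j≢i₀ refl = i≢j (only-i₀ i (∼-trans (∼-neg z∼i₀) (∼-sym i∼-j)))

      indicator∈L : InL H (indicator i₀)
      indicator∈L = All.tabulate (λ {h} → on-hyperplane h)

  private
    between : Λ n → Λ n → Λ n → Bool
    between y t s = P y s ∧ lt y s ∧ lt s t

    no-between⇒gap : ∀ {y t} → any (between y t) (allΛ n) ≡ false
                   → (s : Λ n) → P y s ≡ true → y ≺ s → s ≺ t → ⊥
    no-between⇒gap {y} {t} none s y∼s y≺s s≺t =
      false≢true none (any-intro (between y t) (allΛ-complete s) (∧-intro y∼s (∧-intro y≺s s≺t)))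

    edge-below′ : (y t : Λ n) → Acc _<_ (rank t ∸ rank y) → P y t ≡ true → y ≺ t
                → ∃ λ x → Edge P x t × (x ≡ y ⊎ y ≺ x)
    edge-below′ y t (acc rec) y∼t y≺t with any (between y t) (allΛ n) in eq
    ... | false = y , (y≺t , y∼t , no-between⇒gap {y} {t} eq) , inj₁ refl
    ... | true with any-witness (between y t) (allΛ n) eq
    ...   | s , _ , bet with ∧₃-elim {P y s} {lt y s} {lt s t} bet
    ...     | y∼s , y≺s , s≺t
              with edge-below′ s t (rec (∸-monoʳ-< (rank-mono {s = y} {t = s} y≺s)
                                                   (<⇒≤ (rank-mono {s = s} {t = t} s≺t))))
                               (∼-trans (∼-sym y∼s) y∼t) s≺t
    ...       | x , edge , inj₁ refl = x , edge , inj₂ y≺s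
    ...       | x , edge , inj₂ s≺x  = x , edge , inj₂ (≺-trans {s = y} {t = s} {u = x} y≺s s≺x)

    edge-above′ : (y t : Λ n) → Acc _<_ (rank t ∸ rank y) → P y t ≡ true → y ≺ t
                → ∃ λ x → Edge P y x × (x ≡ t ⊎ x ≺ t)
    edge-above′ y t (acc rec) y∼t y≺t with any (between y t) (allΛ n) in eq
    ... | false = t , (y≺t , y∼t , no-between⇒gap {y} {t} eq) , inj₁ refl
    ... | true with any-witness (between y t) (allΛ n) eq
    ...   | s , _ , bet with ∧₃-elim {P y s} {lt y s} {lt s t} bet
    ...     | y∼s , y≺s , s≺t
              with edge-above′ y s (rec (∸-monoˡ-< (rank-mono {s = s} {t = t} s≺t)
                                                   (<⇒≤ (rank-mono {s = y} {t = s} y≺s))))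
                               y∼s y≺s
    ...       | x , edge , inj₁ refl = x , edge , inj₂ s≺t
    ...       | x , edge , inj₂ x≺s  = x , edge , inj₂ (≺-trans {s = x} {t = s} {u = t} x≺s s≺t)

  edge-below : ∀ {y t} → P y t ≡ true → y ≺ t → ∃ λ x → Edge P x t × (x ≡ y ⊎ y ≺ x)
  edge-below {y} {t} = edge-below′ y t (<-wellFounded _)

  edge-above : ∀ {y t} → P y t ≡ true → y ≺ t → ∃ λ x → Edge P y x × (x ≡ t ⊎ x ≺ t)
  edge-above {y} {t} = edge-above′ y t (<-wellFounded _)

  least-representative : (i : Fin n) → 0 < toℕ i
    → ∃ λ r → leastPos P r ≡ true × P (pos i) (pos r) ≡ true × 0 < toℕ r
  least-representative i = go i (<-wellFounded (toℕ i))
    where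
      go : (i : Fin n) → Acc _<_ (toℕ i) → 0 < toℕ i
         → ∃ λ r → leastPos P r ≡ true × P (pos i) (pos r) ≡ true × 0 < toℕ r
      go i (acc rec) 0<i with leastPos-or-smaller P i 0<i
      ... | inj₁ least = i , least , ∼-refl (pos i) , 0<i
      ... | inj₂ (j , i∼j , 0<j , j<i) with go j (rec j<i) 0<j
      ...   | r , least , j∼r , 0<r = r , least , ∼-trans i∼j j∼r , 0<r

  below-least-nonpositive : ∀ {x j} → leastPos P j ≡ true → P x (pos j) ≡ true → x ≺ pos j → Nonpositive x
  below-least-nonpositive {x} {j} least x∼j x≺j with ≺⇒⊏ {s = x} {t = pos j} x≺j
  ... | neg<pos {i} _ = negative i
  ... | pos<pos {m} m<j with zero⊎positive (toℕ m)
  ...   | inj₁ m≡0 = one m≡0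
  ...   | inj₂ 0<m = ⊥-elim (leastPos-least P least (∼-sym x∼j) 0<m m<j)

  edge-into-least : ∀ {y j} → leastPos P j ≡ true → Nonpositive y → P y (pos j) ≡ true
                  → ∃ λ x → Edge P x (pos j) × Nonpositive x × (x ≡ y ⊎ y ≺ x)
  edge-into-least least y≤0 y∼j with edge-below y∼j (Nonpositive⇒≺positive y≤0 (leastPos-positive P least))
  ... | x , edge@(x≺j , x∼j , _) , y⪯x = x , edge , below-least-nonpositive least x∼j x≺j , y⪯x

  switching-edge : ∀ {j} → leastPos P j ≡ true → switching P j ≡ true
                 → ∃ λ x → Edge P x (pos j) × Nonpositive x
  switching-edge {j} least sw with switching-witness P sw
  ... | t , j∼t , ¬pos with nonpositive-in-block t j∼t ¬pos
    where
      nonpositive-in-block : ∀ t → P (pos j) t ≡ true → isPos t ≡ false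
                           → ∃ λ y → P (pos j) y ≡ true × Nonpositive y
      nonpositive-in-block (pos k) j∼k ¬pos = pos k , j∼k , one (¬isPos⇒≡0 ¬pos)
      nonpositive-in-block (neg k) j∼k _    = neg k , j∼k , negative k
      nonpositive-in-block zer     j∼0 _    = neg j , zero⇒±-pair (∼-sym j∼0) , negative j
  ...   | y , j∼y , y≤0 with edge-into-least least y≤0 (∼-sym j∼y)
  ...     | x , edge , x≤0 , _ = x , edge , x≤0

  ±One-edge : ∀ {a} → leastPos P a ≡ true → hasOne P a ≡ true → ∃ λ y → Edge P y (pos a) × ±One y
  ±One-edge least has with hasOne-witness P has
  ... | y , a∼y , ±y with edge-into-least least (±One⇒Nonpositive ±y) (∼-sym a∼y)
  ...   | x , edge , _   , inj₁ refl = x , edge , ±y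
  ...   | x , edge , x≤0 , inj₂ y≺x  = ⊥-elim (±One-maximal ±y x≤0 y≺x)

  hasOne-opposite : ∀ {a c} → P (pos a) (neg c) ≡ true → hasOne P c ≡ true → hasOne P a ≡ true
  hasOne-opposite a∼-c has-c with hasOne-witness P has-c
  ... | y , c∼y , ±y = hasOne-intro P (∼-trans a∼-c (∼-neg c∼y)) (±One-negΛ ±y)

-- Nonnesting partitions

module NonNestingPartition {n : ℕ} {P : Partition n} (cnn : ClassicalNonNesting P) where

  open ClassicalPartition (proj₁ cnn) public

  private
    nonnesting = proj₂ cnn

  -- An edge from a nonpositive element into j would nest over the edge ending at z.
  below-switching-least : ∀ {j} → leastPos P j ≡ true → switching P j ≡ true
                        → (z : Fin n) → 0 < toℕ z → toℕ z < toℕ j → leastPos P z ≡ true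
  below-switching-least {j} least sw z 0<z z<j with leastPos-or-smaller P z 0<z
  ... | inj₁ least-z = least-z
  ... | inj₂ (w , z∼w , 0<w , w<z)
    with switching-edge least sw | edge-below (∼-sym z∼w) (⊏⇒≺ (pos<pos w<z))
  ...   | x , edge-x , x≤0 | x′ , edge-x′ , w⪯x′ = ⊥-elim
    (nonnesting x x′ (pos z) (pos j) edge-x edge-x′ (x≺x′ w⪯x′) (proj₁ edge-x′) (⊏⇒≺ (pos<pos z<j)))
    where
      x≺x′ : x′ ≡ pos w ⊎ pos w ≺ x′ → x ≺ x′
      x≺x′ (inj₁ refl) = Nonpositive⇒≺positive x≤0 0<w
      x≺x′ (inj₂ w≺x′) = ≺-trans {s = x} {t = pos w} {u = x′} (Nonpositive⇒≺positive x≤0 0<w) w≺x′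

  ±One-upward : ∀ {a b} → leastPos P a ≡ true → hasOne P a ≡ true
              → leastPos P b ≡ true → switching P b ≡ true → toℕ a < toℕ b → hasOne P b ≡ true
  ±One-upward {a} {b} least-a has-a least-b sw-b a<b with ±One-edge least-a has-a | switching-edge least-b sw-b
  ... | _ , _ , _ | x , (_ , x∼b , _) , one e = hasOne-intro P (∼-sym x∼b) (plus-one e)
  ... | y , edge-a , ±y | .(neg k) , edge-b@(_ , k∼b , _) , negative k with zero⊎positive (toℕ k)
  ...   | inj₁ k≡0 = hasOne-intro P (∼-sym k∼b) (minus-one k≡0)
  ...   | inj₂ 0<k =
    ⊥-elim (nonnesting (neg k) y (pos a) (pos b) edge-b edge-a
                       (neg≺±One 0<k ±y) (proj₁ edge-a) (⊏⇒≺ (pos<pos a<b)))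

  next-within-edge : ∀ {σ σ′ j k} → Edge P (pos σ′) (pos j) → toℕ σ < toℕ σ′
                   → P (pos σ) (pos k) ≡ true → toℕ σ < toℕ k
                   → ∃ λ μ → Edge P (pos σ) (pos μ) × toℕ μ ≤ toℕ j
  next-within-edge {σ} {σ′} {j} edge′@(σ′≺j , _ , _) σ<σ′ σ∼k σ<k
    with edge-above σ∼k (⊏⇒≺ (pos<pos σ<k))
  ... | u , edge@(σ≺u , _ , _) , _ with pos≺⇒pos {s = u} σ≺u
  ...   | μ , refl , _ = μ , edge , ≮⇒≥ λ j<μ →
    nonnesting (pos σ) (pos σ′) (pos j) (pos μ) edge edge′
               (⊏⇒≺ (pos<pos σ<σ′)) σ′≺j (⊏⇒≺ (pos<pos j<μ))

  SwitchingAvoiding±1 : Fin n → Set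
  SwitchingAvoiding±1 a = leastPos P a ≡ true × switching P a ≡ true × hasOne P a ≡ false

  partner-edge : ∀ {a c} → SwitchingAvoiding±1 a → SwitchingAvoiding±1 c → P (pos a) (neg c) ≡ true
               → Edge P (neg c) (pos a)
  partner-edge {a} {c} (least-a , _ , avoid-a) (least-c , _ , _) a∼c =
    ⊏⇒≺ (neg<pos (inj₁ (leastPos-positive P least-c))) , ∼-sym a∼c , nothing-between
    where
      nothing-between : (s : Λ n) → P (neg c) s ≡ true → neg c ≺ s → s ≺ pos a → ⊥
      nothing-between s c∼s c≺s s≺a with ≺⇒⊏ {s = neg c} {t = s} c≺s
      nothing-between .(neg k) c∼s _ _ | neg<neg {j = k} k<c with zero⊎positive (toℕ k)
      ... | inj₁ k≡0 = false≢true avoid-a (hasOne-intro P (∼-trans a∼c c∼s) (minus-one k≡0))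
      ... | inj₂ 0<k = leastPos-least P least-c (∼-neg⁻ {pos c} {pos k} c∼s) 0<k k<c
      nothing-between .(pos m) c∼s _ s≺a | neg<pos {j = m} _ with ≺⇒⊏ {s = pos m} {t = pos a} s≺a
      ... | pos<pos m<a with zero⊎positive (toℕ m)
      ...   | inj₁ m≡0 = false≢true avoid-a (hasOne-intro P (∼-trans a∼c c∼s) (plus-one m≡0))
      ...   | inj₂ 0<m = leastPos-least P least-a (∼-trans a∼c c∼s) 0<m m<a

  partner : ∀ {a} → SwitchingAvoiding±1 a → ∃ λ d → SwitchingAvoiding±1 d × P (pos a) (neg d) ≡ true
  partner {a} sa@(least-a , sw-a , avoid-a) with switching-witness P sw-a
  ... | pos k , a∼k , ¬pos = ⊥-elim (false≢true avoid-a (hasOne-intro P a∼k (plus-one (¬isPos⇒≡0 ¬pos))))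
  ... | zer   , a∼0 , _    = a , sa , zero⇒±-pair (∼-sym a∼0)
  ... | neg k , a∼k , _ with zero⊎positive (toℕ k)
  ...   | inj₁ k≡0 = ⊥-elim (false≢true avoid-a (hasOne-intro P a∼k (minus-one k≡0)))
  ...   | inj₂ 0<k with least-representative k 0<k
  ...     | d , least-d , k∼d , _ = d , (least-d , switching-intro P (neg a) d∼-a refl , avoid-d) , a∼-d
    where
      a∼-d : P (pos a) (neg d) ≡ true
      a∼-d = ∼-trans a∼k (∼-neg k∼d)
      d∼-a : P (pos d) (neg a) ≡ true
      d∼-a = ∼-sym (∼-neg {pos a} {neg d} a∼-d)
      avoid-d : hasOne P d ≡ false
      avoid-d = ¬-not (false≢true avoid-a ∘ hasOne-opposite a∼-d)

  partner-antitone : ∀ {a a′ c c′} → SwitchingAvoiding±1 a → SwitchingAvoiding±1 a′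
                   → SwitchingAvoiding±1 c → SwitchingAvoiding±1 c′
                   → P (pos a) (neg c) ≡ true → P (pos a′) (neg c′) ≡ true
                   → toℕ a < toℕ a′ → toℕ c′ < toℕ c
  partner-antitone {a} {a′} {c} {c′} sa sa′ sc sc′ a∼c a′∼c′ a<a′ with <-cmp (toℕ c′) (toℕ c)
  ... | tri< c′<c _ _ = c′<c
  ... | tri≈ _ c′≡c _ with toℕ-injective c′≡c
  ...   | refl =
    ⊥-elim (leastPos-least P (proj₁ sa′) (∼-trans a′∼c′ (∼-sym a∼c)) (leastPos-positive P (proj₁ sa)) a<a′)
  partner-antitone {a} {a′} {c} {c′} sa sa′ sc sc′ a∼c a′∼c′ a<a′ | tri> _ _ c<c′ =
    ⊥-elim (nonnesting (neg c′) (neg c) (pos a) (pos a′) (partner-edge sa′ sc′ a′∼c′) (partner-edge sa sc a∼c)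
                       (⊏⇒≺ (neg<neg c<c′)) (⊏⇒≺ (neg<pos (inj₁ (leastPos-positive P (proj₁ sc)))))
                       (⊏⇒≺ (pos<pos a<a′)))

-- Two partitions with the same statistics

record SameStatistics {n : ℕ} (P Q : Partition n) : Set where
  field
    nonnestingP : ClassicalNonNesting P
    nonnestingQ : ClassicalNonNesting Q
    a-equal : aStat P ≡ aStat Q
    μ-equal : μStat P ≡ μStat Q
    ν-equal : νStat P ≡ νStat Q
    c-equal : cStat P ≡ cStat Q

swap : {n : ℕ} {P Q : Partition n} → SameStatistics P Q → SameStatistics Q P
swap S = record
  { nonnestingP = nonnestingQ ; nonnestingQ = nonnestingP
  ; a-equal = sym a-equal ; μ-equal = sym μ-equal ; ν-equal = sym ν-equal ; c-equal = sym c-equal }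
  where open SameStatistics S

module Counting {n : ℕ} {P Q : Partition n} (S : SameStatistics P Q) where

  open SameStatistics S
  module P′ = NonNestingPartition nonnestingP
  module Q′ = NonNestingPartition nonnestingQ

  Mreps-equal : Mreps P ≡ Mreps Q
  Mreps-equal = map-injective (λ e → toℕ-injective (suc-injective e)) a-equal

  isMrep-equal : ∀ i → isMrep P i ≡ isMrep Q i
  isMrep-equal i =
    filterᵇ-injective-on (allFin n) (trans (sym (Mreps≡ P)) (trans Mreps-equal (Mreps≡ Q))) (∈-allFin i)

  positiveCount-Mrep : ∀ {i} → isMrep P i ≡ true → positiveCount P i ≡ positiveCount Q i
  positiveCount-Mrep {i} m = begin
    positiveCount P i         ≡⟨ posNonSwitching⇒positiveCount≡size P (∧-conicalʳ (leastPos P i) _ m) ⟩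
    length (block P (pos i))  ≡⟨ map-injective-on (Mreps P) (trans μ-equal (cong (map _) (sym Mreps-equal))) i∈Mreps ⟩
    length (block Q (pos i))  ≡⟨ posNonSwitching⇒positiveCount≡size Q (∧-conicalʳ (leastPos Q i) _ mQ) ⟨
    positiveCount Q i         ∎
    where
      open ≡-Reasoning
      mQ = trans (sym (isMrep-equal i)) m
      i∈Mreps = subst (i ∈_) (sym (Mreps≡ P)) (∈-filterᵇ⁺ (isMrep P) (∈-allFin i) m)

  #Preps-equal : length (filterᵇ (isPrep P) (allFin n)) ≡ length (filterᵇ (isPrep Q) (allFin n))
  #Preps-equal = begin
    length (filterᵇ (isPrep P) (allFin n))  ≡⟨ cong length (Preps≡ P) ⟨
    length (Preps P)                        ≡⟨ length-map _ (Preps P) ⟨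
    length (νStat P)                        ≡⟨ cong length ν-equal ⟩
    length (νStat Q)                        ≡⟨ length-map _ (Preps Q) ⟩
    length (Preps Q)                        ≡⟨ cong length (Preps≡ Q) ⟩
    length (filterᵇ (isPrep Q) (allFin n))  ∎
    where open ≡-Reasoning

  AgreeBelow : ℕ → Set
  AgreeBelow t = ∀ i j → 0 < toℕ i → 0 < toℕ j → toℕ i < t → toℕ j < t
                → P (pos i) (pos j) ≡ Q (pos i) (pos j)

  module _ {t : ℕ} (agree : AgreeBelow t) where

    leastPos-agree : ∀ r → toℕ r < t → leastPos P r ≡ leastPos Q r
    leastPos-agree r r<t = leastPos-local P Q λ j 0<j j<r →
      agree r j (≤-<-trans z≤n j<r) 0<j r<t (<-trans j<r r<t)

    isPrep-agree : ∀ r → toℕ r < t → isPrep P r ≡ isPrep Q r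
    isPrep-agree r r<t = begin
      isPrep P r                        ≡⟨ isPrep≡ P r ⟩
      leastPos P r ∧ not (isMrep P r)   ≡⟨ cong₂ (λ a b → a ∧ not b) (leastPos-agree r r<t) (isMrep-equal r) ⟩
      leastPos Q r ∧ not (isMrep Q r)   ≡⟨ isPrep≡ Q r ⟨
      isPrep Q r                        ∎
      where open ≡-Reasoning

    -- Positive counts are μ-entries for nonswitching blocks and ν-entries for switching
    -- ones, read off at the same position because the representatives agree below r.
    positiveCount-agree : ∀ {r} → leastPos P r ≡ true → toℕ r < t → positiveCount P r ≡ positiveCount Q r
    positiveCount-agree {r} least r<t with isMrep P r in m
    ... | true  = positiveCount-Mrep m
    ... | false = map-filterᵇ-aligned (isPrep P) (isPrep Q) (positiveCount P) (positiveCount Q) (allFin n)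
                    allFin-increasing (∈-allFin r) prepP (trans (sym (isPrep-agree r r<t)) prepP)
                    (λ y y<r → isPrep-agree y (<-trans y<r r<t))
                    (trans (cong (map _) (sym (Preps≡ P))) (trans ν-equal (cong (map _) (Preps≡ Q))))
      where
        prepP : isPrep P r ≡ true
        prepP = trans (isPrep≡ P r) (cong₂ (λ a b → a ∧ not b) least m)

  -- If P attaches j to σ and Q attaches j to σ′ > σ, then σ's block is still open at j in P
  -- but already complete in Q (nonnesting forbids Q from using it later), so its positive
  -- counts differ unless σ and σ′ are in the same block.
  predecessors-in-same-block : ∀ {j σ σ′} → AgreeBelow (toℕ j)
    → Edge P (pos σ) (pos j) → Edge Q (pos σ′) (pos j)
    → 0 < toℕ σ → 0 < toℕ σ′ → toℕ σ < toℕ σ′ → P (pos σ) (pos σ′) ≡ true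
  predecessors-in-same-block {j} {σ} {σ′} agree (σ≺j , σ∼j , gapP) edgeQ′@(σ′≺j , σ′∼j , _)
                             0<σ 0<σ′ σ<σ′
    with P (pos σ) (pos σ′) in σ≁σ′
  ... | true  = refl
  ... | false with P′.least-representative σ 0<σ
  ...   | r , least-r , σ∼r , 0<r = ⊥-elim (<-irrefl (sym (positiveCount-agree agree least-r r<j)) Q-count<P-count)
    where
      σ<j : toℕ σ < toℕ j
      σ<j = pos≺pos⇒< {i = σ} {j = j} σ≺j
      σ′<j : toℕ σ′ < toℕ j
      σ′<j = pos≺pos⇒< {i = σ′} {j = j} σ′≺j
      r<j : toℕ r < toℕ j
      r<j = ≤-<-trans (≮⇒≥ λ σ<r → leastPos-least P least-r (P′.∼-sym σ∼r) 0<σ σ<r) σ<j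

      Qσj-impossible : Q (pos σ) (pos j) ≡ true → ⊥
      Qσj-impossible σ∼j =
        false≢true σ≁σ′ (trans (agree σ σ′ 0<σ 0<σ′ σ<j σ′<j)
                               (Q′.∼-trans σ∼j (Q′.∼-sym σ′∼j)))

      Qσr : Q (pos σ) (pos r) ≡ true
      Qσr = trans (sym (agree σ r 0<σ 0<r σ<j r<j)) σ∼r

      Qσ-not-above-j : ∀ k → toℕ j < toℕ k → Q (pos σ) (pos k) ≡ true → ⊥
      Qσ-not-above-j k j<k σ∼k with Q′.next-within-edge edgeQ′ σ<σ′ σ∼k (<-trans σ<j j<k)
      ... | μ , (σ≺μ , σ∼μ , _) , μ≤j with m≤n⇒m<n∨m≡n μ≤j
      ...   | inj₁ μ<j = gapP (pos μ) (trans (agree σ μ 0<σ 0<μ σ<j μ<j) σ∼μ) σ≺μ (⊏⇒≺ (pos<pos μ<j))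
        where 0<μ = <-trans 0<σ (pos≺pos⇒< {i = σ} {j = μ} σ≺μ)
      ...   | inj₂ μ≡j = Qσj-impossible (subst (λ v → Q (pos σ) (pos v) ≡ true) (toℕ-injective μ≡j) σ∼μ)

      Q-block-below-j : ∀ k → Q (pos r) (pos k) ≡ true → toℕ k < toℕ j
      Q-block-below-j k r∼k with <-cmp (toℕ k) (toℕ j)
      ... | tri< k<j _ _ = k<j
      ... | tri≈ _ k≡j _ rewrite toℕ-injective k≡j = ⊥-elim (Qσj-impossible (Q′.∼-trans Qσr r∼k))
      ... | tri> _ _ j<k = ⊥-elim (Qσ-not-above-j k j<k (Q′.∼-trans Qσr r∼k))

      Q-block⊆P-block : ∀ x → (Q (pos r) x ∧ isPos x) ≡ true → (P (pos r) x ∧ isPos x) ≡ true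
      Q-block⊆P-block (pos k) e = ∧-intro (trans (agree r k 0<r (<ᵇ⇒<′ k>0) r<j (Q-block-below-j k r∼k)) r∼k) k>0
        where
          r∼k = ∧-conicalˡ (Q (pos r) (pos k)) _ e
          k>0 = ∧-conicalʳ (Q (pos r) (pos k)) _ e
      Q-block⊆P-block (neg k) e = ⊥-elim (false≢true (∧-zeroʳ (Q (pos r) (neg k))) e)
      Q-block⊆P-block zer     e = ⊥-elim (false≢true (∧-zeroʳ (Q (pos r) zer)) e)

      Q-count<P-count : positiveCount Q r < positiveCount P r
      Q-count<P-count = subst₂ _<_ (sym (positiveCount≡ Q r)) (sym (positiveCount≡ P r))
        (length-filterᵇ-< _ _ (allΛ n) Q-block⊆P-block (allΛ-complete (pos j))
          (cong (_∧ isPos (pos j)) (¬-not (Qσj-impossible ∘ Q′.∼-trans Qσr)))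
          (∧-intro (P′.∼-trans (P′.∼-sym σ∼r) σ∼j) (<⇒<ᵇ′ (<-trans 0<σ σ<j))))

  -- Otherwise Q would have strictly more switching representatives than P.
  not-new-switching-rep : ∀ {i j} → AgreeBelow (toℕ j) → 0 < toℕ i → toℕ i < toℕ j
                        → P (pos i) (pos j) ≡ true → isPrep Q j ≡ true → ⊥
  not-new-switching-rep {i} {j} agree 0<i i<j i∼j prepQ =
    <-irrefl #Preps-equal (length-filterᵇ-< (isPrep P) (isPrep Q) (allFin n) P⊆Q (∈-allFin j) prepP-false prepQ)
    where
      not-least : leastPos P j ≡ true → ⊥
      not-least least = leastPos-least P least (P′.∼-sym i∼j) 0<i i<j
      prepP-false : isPrep P j ≡ false
      prepP-false = ¬-not (not-least ∘ ∧-conicalˡ (leastPos P j) _)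
      P⊆Q : ∀ y → isPrep P y ≡ true → isPrep Q y ≡ true
      P⊆Q y e with <-cmp (toℕ y) (toℕ j)
      ... | tri< y<j _ _ = trans (sym (isPrep-agree agree y y<j)) e
      ... | tri≈ _ y≡j _ rewrite toℕ-injective y≡j = ⊥-elim (not-least (∧-conicalˡ (leastPos P j) _ e))
      ... | tri> _ _ j<y = ⊥-elim (not-least (P′.below-switching-least (∧-conicalˡ (leastPos P y) _ e)
                                                 (∧-conicalʳ (leastPos P y) _ e) j (<-trans 0<i i<j) j<y))

module Extension {n : ℕ} {P Q : Partition n} (S : SameStatistics P Q) where

  open Counting S
  private
    module C′ = Counting (swap S)

  flip-agree : ∀ {t} → AgreeBelow t → C′.AgreeBelow t
  flip-agree agree i j 0<i 0<j i<t j<t = sym (agree i j 0<i 0<j i<t j<t)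

  extend-agreement : ∀ {i j} → AgreeBelow (toℕ j) → 0 < toℕ i → toℕ i < toℕ j
                   → P (pos i) (pos j) ≡ true → Q (pos i) (pos j) ≡ true
  extend-agreement {i} {j} agree 0<i i<j i∼j with leastPos-or-smaller Q j (<-trans 0<i i<j)
  ... | inj₁ least-Q with isMrep Q j in m
  ...   | true  = ⊥-elim
    (leastPos-least P (∧-conicalˡ (leastPos P j) _ (trans (isMrep-equal j) m)) (P′.∼-sym i∼j) 0<i i<j)
  ...   | false = ⊥-elim
    (not-new-switching-rep agree 0<i i<j i∼j (trans (isPrep≡ Q j) (cong₂ (λ a b → a ∧ not b) least-Q m)))
  extend-agreement {i} {j} agree 0<i i<j i∼j | inj₂ (w , j∼w , 0<w , w<j)
    with P′.edge-below i∼j (⊏⇒≺ (pos<pos i<j)) | Q′.edge-below (Q′.∼-sym j∼w) (⊏⇒≺ (pos<pos w<j))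
  ... | s , edgeP , i⪯s | s′ , edgeQ , w⪯s′
    with positive-at-or-above {s = s} 0<i i⪯s | positive-at-or-above {s = s′} 0<w w⪯s′
  ... | σ , refl , 0<σ | σ′ , refl , 0<σ′ = Q′.∼-trans Qiσ (Q′.∼-trans Qσσ′ (proj₁ (proj₂ edgeQ)))
    where
      σ<j : toℕ σ < toℕ j
      σ<j = pos≺pos⇒< {i = σ} {j = j} (proj₁ edgeP)
      σ′<j : toℕ σ′ < toℕ j
      σ′<j = pos≺pos⇒< {i = σ′} {j = j} (proj₁ edgeQ)
      Qiσ : Q (pos i) (pos σ) ≡ true
      Qiσ = trans (sym (agree i σ 0<i 0<σ i<j σ<j)) (P′.∼-trans i∼j (P′.∼-sym (proj₁ (proj₂ edgeP))))
      Pσσ′ : P (pos σ) (pos σ′) ≡ true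
      Pσσ′ with <-cmp (toℕ σ) (toℕ σ′)
      ... | tri< σ<σ′ _ _ = predecessors-in-same-block agree edgeP edgeQ 0<σ 0<σ′ σ<σ′
      ... | tri≈ _ σ≡σ′ _ rewrite toℕ-injective σ≡σ′ = P′.∼-refl (pos σ′)
      ... | tri> _ _ σ′<σ = P′.∼-sym (trans (agree σ′ σ 0<σ′ 0<σ σ′<j σ<j)
                              (C′.predecessors-in-same-block (flip-agree agree) edgeQ edgeP 0<σ′ 0<σ σ′<σ))
      Qσσ′ : Q (pos σ) (pos σ′) ≡ true
      Qσσ′ = trans (sym (agree σ σ′ 0<σ 0<σ′ σ<j σ′<j)) Pσσ′

module PositiveAgreement {n : ℕ} {P Q : Partition n} (S : SameStatistics P Q) where

  open Counting S public
  open Extension S using (flip-agree; extend-agreement)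

  private
    module E′ = Extension (swap S)

    agree-at-top : ∀ {t} → AgreeBelow t → ∀ i j → 0 < toℕ i → toℕ i < t → toℕ j ≡ t
                 → P (pos i) (pos j) ≡ Q (pos i) (pos j)
    agree-at-top agree i j 0<i i<t refl =
      bool-ext (extend-agreement agree 0<i i<t) (E′.extend-agreement (flip-agree agree) 0<i i<t)

  agree-below : ∀ t → AgreeBelow t
  agree-below zero    i j _ _ () _
  agree-below (suc t) i j 0<i 0<j i≤t j≤t with m<1+n⇒m<n∨m≡n i≤t | m<1+n⇒m<n∨m≡n j≤t
  ... | inj₁ i<t | inj₁ j<t = agree-below t i j 0<i 0<j i<t j<t
  ... | inj₁ i<t | inj₂ j≡t = agree-at-top (agree-below t) i j 0<i i<t j≡t
  ... | inj₂ i≡t | inj₁ j<t =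
    trans (P′.∼-comm (pos i) (pos j))
          (trans (agree-at-top (agree-below t) j i 0<j j<t i≡t) (Q′.∼-comm (pos j) (pos i)))
  ... | inj₂ i≡t | inj₂ j≡t with toℕ-injective (trans i≡t (sym j≡t))
  ...   | refl = trans (P′.∼-refl (pos i)) (sym (Q′.∼-refl (pos i)))

  positive-agree : ∀ i j → 0 < toℕ i → 0 < toℕ j → P (pos i) (pos j) ≡ Q (pos i) (pos j)
  positive-agree i j 0<i 0<j = agree-below n i j 0<i 0<j (toℕ<n i) (toℕ<n j)

  leastPos-equal : ∀ r → leastPos P r ≡ leastPos Q r
  leastPos-equal r = leastPos-agree (agree-below n) r (toℕ<n r)

  isPrep-equal : ∀ r → isPrep P r ≡ isPrep Q r
  isPrep-equal r = isPrep-agree (agree-below n) r (toℕ<n r)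

  switching-equal : ∀ {r} → leastPos P r ≡ true → switching P r ≡ switching Q r
  switching-equal {r} least = begin
    switching P r                   ≡⟨ cong (_∧ switching P r) least ⟨
    leastPos P r ∧ switching P r    ≡⟨ isPrep-equal r ⟩
    leastPos Q r ∧ switching Q r    ≡⟨ cong (_∧ switching Q r) (trans (sym (leastPos-equal r)) least) ⟩
    switching Q r                   ∎
    where open ≡-Reasoning

module RepresentativesOf±1 {n : ℕ} {P Q : Partition n} (S : SameStatistics P Q) where

  open SameStatistics S using (c-equal)
  open PositiveAgreement S

  #Rreps-equal : length (filterᵇ (isRrep P) (allFin n)) ≡ length (filterᵇ (isRrep Q) (allFin n))
  #Rreps-equal = begin
    length (filterᵇ (isRrep P) (allFin n))  ≡⟨ cong length (Rreps≡ P) ⟨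
    length (Rreps P)                        ≡⟨ length-map _ (Rreps P) ⟨
    length (cStat P)                        ≡⟨ cong length c-equal ⟩
    length (cStat Q)                        ≡⟨ length-map _ (Rreps Q) ⟩
    length (Rreps Q)                        ≡⟨ cong length (Rreps≡ Q) ⟩
    length (filterᵇ (isRrep Q) (allFin n))  ∎
    where open ≡-Reasoning

  -- The blocks meeting ±1 are the switching blocks with the largest least positive
  -- elements, so an extra one in P would leave Q with fewer of them.
  isRrep-transfer : ∀ a → isRrep P a ≡ true → isRrep Q a ≡ true
  isRrep-transfer a rP with isRrep Q a in rQ
  ... | true  = refl
  ... | false = ⊥-elim (<-irrefl (sym #Rreps-equal)
                  (length-filterᵇ-< (isRrep Q) (isRrep P) (allFin n) Q⊆P (∈-allFin a) rQ rP))
    where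
      least-P : leastPos P a ≡ true
      least-P = ∧-conicalˡ (leastPos P a) _ rP
      has-P : hasOne P a ≡ true
      has-P = ∧-conicalʳ (leastPos P a) _ rP
      least-Q : leastPos Q a ≡ true
      least-Q = trans (sym (leastPos-equal a)) least-P

      Q⊆P : ∀ b → isRrep Q b ≡ true → isRrep P b ≡ true
      Q⊆P b rQb with <-cmp (toℕ b) (toℕ a)
      ... | tri< b<a _ _ = ⊥-elim (false≢true rQ (∧-intro least-Q
              (Q′.±One-upward (∧-conicalˡ (leastPos Q b) _ rQb) (∧-conicalʳ (leastPos Q b) _ rQb) least-Q
                 (trans (sym (switching-equal least-P)) (hasOne⇒switching P has-P)) b<a)))
      ... | tri≈ _ b≡a _ rewrite toℕ-injective b≡a = ⊥-elim (false≢true rQ rQb)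
      ... | tri> _ _ a<b = ∧-intro least-Pb
              (P′.±One-upward least-P has-P least-Pb
                 (trans (switching-equal least-Pb) (hasOne⇒switching Q has-Qb)) a<b)
        where
          has-Qb = ∧-conicalʳ (leastPos Q b) _ rQb
          least-Pb = trans (leastPos-equal b) (∧-conicalˡ (leastPos Q b) _ rQb)

module ±1Agreement {n : ℕ} {P Q : Partition n} (S : SameStatistics P Q) where

  open SameStatistics S using (c-equal)
  open PositiveAgreement S
  private
    module R  = RepresentativesOf±1 S
    module R′ = RepresentativesOf±1 (swap S)

  isRrep-equal : ∀ a → isRrep P a ≡ isRrep Q a
  isRrep-equal a = bool-ext (R.isRrep-transfer a) (R′.isRrep-transfer a)

  Rreps-equal : Rreps P ≡ Rreps Q
  Rreps-equal = trans (Rreps≡ P) (trans (filterᵇ-cong (allFin n) isRrep-equal) (sym (Rreps≡ Q)))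

  ±One-agree : ∀ {i y} → 0 < toℕ i → ±One y → P (pos i) y ≡ true → Q (pos i) y ≡ true
  ±One-agree {i} {y} 0<i ±y i∼y with P′.least-representative i 0<i
  ... | r , least-r , i∼r , 0<r = Q′.∼-trans (trans (sym (positive-agree i r 0<i 0<r)) i∼r) (r-block ±y r∼y)
    where
      r∼y : P (pos r) y ≡ true
      r∼y = P′.∼-trans (P′.∼-sym i∼r) i∼y

      r∈Rreps : r ∈ Rreps P
      r∈Rreps = subst (r ∈_) (sym (Rreps≡ P))
                      (∈-filterᵇ⁺ (isRrep P) (∈-allFin r) (∧-intro least-r (hasOne-intro P r∼y ±y)))

      c-at-r : (any isOne (block P (pos r)) , any isMinusOne (block P (pos r)))
             ≡ (any isOne (block Q (pos r)) , any isMinusOne (block Q (pos r)))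
      c-at-r = map-injective-on (Rreps P) (trans c-equal (cong (map _) (sym Rreps-equal))) r∈Rreps

      from-c : (f : Λ n → Bool) {y : Λ n} → any f (block P (pos r)) ≡ any f (block Q (pos r))
             → (∀ {t} → f t ≡ true → t ≡ y) → f y ≡ true → P (pos r) y ≡ true → Q (pos r) y ≡ true
      from-c f {y} same unique fy r∼y
        with block-any-witness Q f (pos r) (trans (sym same) (block-any-intro P f y r∼y fy))
      ... | t , r∼t , ft = subst (λ v → Q (pos r) v ≡ true) (unique ft) r∼t

      r-block : ∀ {y} → ±One y → P (pos r) y ≡ true → Q (pos r) y ≡ true
      r-block (plus-one k≡0)  = from-c isOne      (cong proj₁ c-at-r) (isOne⇒≡pos k≡0)      (≡⇒≡ᵇ′ k≡0)
      r-block (minus-one k≡0) = from-c isMinusOne (cong proj₂ c-at-r) (isMinusOne⇒≡neg k≡0) (≡⇒≡ᵇ′ k≡0)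

  SwitchingAvoiding±1-transfer : ∀ {a} → P′.SwitchingAvoiding±1 a → Q′.SwitchingAvoiding±1 a
  SwitchingAvoiding±1-transfer {a} (least , sw , avoid) =
    least-Q , trans (sym (switching-equal least)) sw , ¬-not avoid-Q
    where
      least-Q = trans (sym (leastPos-equal a)) least
      avoid-Q : hasOne Q a ≡ true → ⊥
      avoid-Q has = false≢true avoid (∧-conicalʳ (leastPos P a) _ (trans (isRrep-equal a) (∧-intro least-Q has)))

module PartnerDescent {n : ℕ} {P Q : Partition n} (S : SameStatistics P Q) where

  open PositiveAgreement S using (module P′; module Q′)
  private
    module A  = ±1Agreement S
    module A′ = ±1Agreement (swap S)

  -- Passing to the Q-partner e of c and then to the P-partner f of e reproduces the
  -- configuration with (a, c, d) replaced by (e, f, c), so d strictly decreases.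
  no-larger-Q-partner : ∀ {a c d}
    → P′.SwitchingAvoiding±1 a → P′.SwitchingAvoiding±1 c → P′.SwitchingAvoiding±1 d
    → P (pos a) (neg c) ≡ true → Q (pos a) (neg d) ≡ true → ¬ toℕ c < toℕ d
  no-larger-Q-partner {d = d} = descent d (<-wellFounded (toℕ d))
    where
      descent : ∀ d → Acc _<_ (toℕ d) → ∀ {a c}
        → P′.SwitchingAvoiding±1 a → P′.SwitchingAvoiding±1 c → P′.SwitchingAvoiding±1 d
        → P (pos a) (neg c) ≡ true → Q (pos a) (neg d) ≡ true → ¬ toℕ c < toℕ d
      descent d (acc rec) {a} {c} sa sc sd a∼c a≈d c<d with Q′.partner (A.SwitchingAvoiding±1-transfer sc)
      ... | e , se , c≈e with P′.partner (A′.SwitchingAvoiding±1-transfer se)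
      ...   | f , sf , e∼f = descent c (rec c<d) (A′.SwitchingAvoiding±1-transfer se) sf sc e∼f e≈c f<c
        where
          d≈a : Q (pos d) (neg a) ≡ true
          d≈a = Q′.∼-sym (Q′.∼-neg {pos a} {neg d} a≈d)
          e≈c : Q (pos e) (neg c) ≡ true
          e≈c = Q′.∼-sym (Q′.∼-neg {pos c} {neg e} c≈e)
          a<e : toℕ a < toℕ e
          a<e = Q′.partner-antitone (A.SwitchingAvoiding±1-transfer sc) (A.SwitchingAvoiding±1-transfer sd)
                                    se (A.SwitchingAvoiding±1-transfer sa) c≈e d≈a c<d
          f<c : toℕ f < toℕ c
          f<c = P′.partner-antitone sa (A′.SwitchingAvoiding±1-transfer se) sc sf a∼c e∼f a<e

module Agreement {n : ℕ} {P Q : Partition n} (S : SameStatistics P Q) where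

  open PositiveAgreement S using (module P′; module Q′; positive-agree)
  open ±1Agreement S using (±One-agree; SwitchingAvoiding±1-transfer)
  private
    module A′ = ±1Agreement (swap S)
    module D  = PartnerDescent S
    module D′ = PartnerDescent (swap S)

  partner-agree : ∀ {a c} → P′.SwitchingAvoiding±1 a → P′.SwitchingAvoiding±1 c
                → P (pos a) (neg c) ≡ true → Q (pos a) (neg c) ≡ true
  partner-agree {a} {c} sa sc a∼c with Q′.partner (SwitchingAvoiding±1-transfer sa)
  ... | d , sd , a≈d with <-cmp (toℕ c) (toℕ d)
  ...   | tri< c<d _ _ = ⊥-elim (D.no-larger-Q-partner sa sc (A′.SwitchingAvoiding±1-transfer sd) a∼c a≈d c<d)
  ...   | tri≈ _ c≡d _ = subst (λ v → Q (pos a) (neg v) ≡ true) (sym (toℕ-injective c≡d)) a≈d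
  ...   | tri> _ _ d<c = ⊥-elim (D′.no-larger-Q-partner (SwitchingAvoiding±1-transfer sa) sd
                                   (SwitchingAvoiding±1-transfer sc) a≈d a∼c d<c)

  positive-negative-agree : ∀ {i j} → 0 < toℕ i → 0 < toℕ j
                          → P (pos i) (neg j) ≡ true → Q (pos i) (neg j) ≡ true
  positive-negative-agree {i} {j} 0<i 0<j i∼-j with P′.least-representative i 0<i | P′.least-representative j 0<j
  ... | a , least-a , i∼a , 0<a | c , least-c , j∼c , 0<c =
    Q′.∼-trans (trans (sym (positive-agree i a 0<i 0<a)) i∼a)
               (Q′.∼-trans reps-agree
                  (Q′.∼-neg {pos c} {pos j} (Q′.∼-sym (trans (sym (positive-agree j c 0<j 0<c)) j∼c))))
    where
      a∼-c : P (pos a) (neg c) ≡ true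
      a∼-c = P′.∼-trans (P′.∼-sym i∼a) (P′.∼-trans i∼-j (P′.∼-neg {pos j} {pos c} j∼c))
      reps-agree : Q (pos a) (neg c) ≡ true
      reps-agree with hasOne P a in has-a
      ... | true with hasOne-witness P has-a
      ...   | y , a∼y , ±y = Q′.∼-trans (±One-agree 0<a ±y a∼y) (Q′.∼-sym -c≈y)
        where
          -c≈y : Q (neg c) y ≡ true
          -c≈y = Q′.∼-neg⁻ {neg c} {y}
                   (±One-agree 0<c (±One-negΛ ±y) (P′.∼-neg {neg c} {y} (P′.∼-trans (P′.∼-sym a∼-c) a∼y)))
      reps-agree | false = partner-agree (least-a , switching-intro P (neg c) a∼-c refl , has-a)
                                         (least-c , switching-intro P (neg a) c∼-a refl , avoid-c) a∼-c
        where
          c∼-a : P (pos c) (neg a) ≡ true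
          c∼-a = P′.∼-sym (P′.∼-neg {pos a} {neg c} a∼-c)
          avoid-c : hasOne P c ≡ false
          avoid-c = ¬-not (false≢true has-a ∘ P′.hasOne-opposite a∼-c)

  private
    zero-agree-positive : ∀ {i} → 0 < toℕ i → P zer (pos i) ≡ true → Q zer (pos i) ≡ true
    zero-agree-positive 0<i z∼i = Q′.±-pair⇒zero (positive-negative-agree 0<i 0<i (P′.zero⇒±-pair z∼i))

  zero-agree : ∀ i → P zer (pos i) ≡ true → Q zer (pos i) ≡ true
  zero-agree i z∼i with zero⊎positive (toℕ i)
  ... | inj₂ 0<i = zero-agree-positive 0<i z∼i
  ... | inj₁ i≡0 with P′.zero-block-has-two i z∼i
  ...   | k , k≢i , z∼k with zero⊎positive (toℕ k)
  ...     | inj₁ k≡0 = ⊥-elim (k≢i (toℕ-injective (trans k≡0 (sym i≡0))))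
  ...     | inj₂ 0<k = Q′.∼-trans (zero-agree-positive 0<k z∼k)
                                  (±One-agree 0<k (plus-one i≡0) (P′.∼-trans (P′.∼-sym z∼k) z∼i))

  pos-pos-agree : ∀ i j → P (pos i) (pos j) ≡ true → Q (pos i) (pos j) ≡ true
  pos-pos-agree i j i∼j with zero⊎positive (toℕ i) | zero⊎positive (toℕ j)
  ... | inj₂ 0<i | inj₂ 0<j = trans (sym (positive-agree i j 0<i 0<j)) i∼j
  ... | inj₂ 0<i | inj₁ j≡0 = ±One-agree 0<i (plus-one j≡0) i∼j
  ... | inj₁ i≡0 | inj₂ 0<j = Q′.∼-sym (±One-agree 0<j (plus-one i≡0) (P′.∼-sym i∼j))
  ... | inj₁ i≡0 | inj₁ j≡0 rewrite toℕ-injective (trans i≡0 (sym j≡0)) = Q′.∼-refl (pos j)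

  pos-neg-agree : ∀ i j → P (pos i) (neg j) ≡ true → Q (pos i) (neg j) ≡ true
  pos-neg-agree i j i∼-j with zero⊎positive (toℕ i) | zero⊎positive (toℕ j)
  ... | inj₂ 0<i | inj₂ 0<j = positive-negative-agree 0<i 0<j i∼-j
  ... | inj₂ 0<i | inj₁ j≡0 = ±One-agree 0<i (minus-one j≡0) i∼-j
  ... | inj₁ i≡0 | inj₂ 0<j =
    Q′.∼-neg⁻ {pos i} {neg j}
      (Q′.∼-sym (±One-agree 0<j (minus-one i≡0) (P′.∼-sym (P′.∼-neg {pos i} {neg j} i∼-j))))
  ... | inj₁ i≡0 | inj₁ j≡0 rewrite toℕ-injective (trans i≡0 (sym j≡0)) =
    Q′.zero⇒±-pair (zero-agree j (P′.±-pair⇒zero i∼-j))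

  same-block-transfer : ∀ s t → P s t ≡ true → Q s t ≡ true
  same-block-transfer (pos i) (pos j) = pos-pos-agree i j
  same-block-transfer (pos i) (neg j) = pos-neg-agree i j
  same-block-transfer (pos i) zer     = Q′.∼-sym ∘ zero-agree i ∘ P′.∼-sym
  same-block-transfer (neg i) (pos j) = Q′.∼-sym ∘ pos-neg-agree j i ∘ P′.∼-sym
  same-block-transfer (neg i) (neg j) = Q′.∼-neg {pos i} {pos j} ∘ pos-pos-agree i j ∘ P′.∼-neg {neg i} {neg j}
  same-block-transfer (neg i) zer     =
    Q′.∼-neg {pos i} {zer} ∘ Q′.∼-sym ∘ zero-agree i ∘ P′.∼-sym ∘ P′.∼-neg {neg i} {zer}
  same-block-transfer zer     (pos j) = zero-agree j
  same-block-transfer zer     (neg j) = Q′.∼-neg {zer} {pos j} ∘ zero-agree j ∘ P′.∼-neg {zer} {neg j}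
  same-block-transfer zer     zer     = λ _ → Q′.∼-refl zer

lemma2p11 : (n : ℕ) (P Q : Partition n)
    → ClassicalNonNesting P → ClassicalNonNesting Q
    → aStat P ≡ aStat Q → μStat P ≡ μStat Q → νStat P ≡ νStat Q → cStat P ≡ cStat Q
    → (s t : Λ n) → P s t ≡ Q s t
lemma2p11 n P Q cnnP cnnQ a-equal μ-equal ν-equal c-equal s t =
  bool-ext (Agreement.same-block-transfer S s t) (Agreement.same-block-transfer (swap S) s t)
  where
    S : SameStatistics P Q
    S = record { nonnestingP = cnnP ; nonnestingQ = cnnQ
               ; a-equal = a-equal ; μ-equal = μ-equal ; ν-equal = ν-equal ; c-equal = c-equal }
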